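{- (ZFC) There exists an injection $f:[\omega]^\omega\rightarrow[\omega]^\omega$ such that for each $x\in[\omega]^\omega$, $f(x)$ is a proper subset of $x$.
   Context: $[\omega]^\omega$ denotes the set of infinite subsets of $\omega$. -}

module Defs where

open import Level using (0ℓ)
open import Data.Nat using (ℕ; _≤_)
open import Data.Bool using (Bool; true; false)
open import Data.Product using (Σ; ∃; _×_; proj₁)
open import Relation.Binary.PropositionalEquality using (_≡_)
open import Relation.Binary.Bundles using (Setoid)
open import Relation.Binary.Structures using (IsStrictTotalOrder)
open import Induction.WellFounded using (WellFounded)
open import Axiom.ExcludedMiddle using (ExcludedMiddle)

-- Subsets of ω = ℕ, as characteristic functions (under LEM these are all subsets).
Subset : Set
Subset = ℕ → Bool

_≐_ : Subset → Subset → Set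
x ≐ y = ∀ n → x n ≡ y n

Infinite : Subset → Set
Infinite x = ∀ n → ∃ λ m → n ≤ m × x m ≡ true

InfSubset : Set
InfSubset = Σ Subset Infinite

_≐ᵢ_ : InfSubset → InfSubset → Set
x ≐ᵢ y = proj₁ x ≐ proj₁ y

_⊊_ : Subset → Subset → Set
y ⊊ x = (∀ n → y n ≡ true → x n ≡ true) × ∃ λ n → x n ≡ true × y n ≡ false

record WellOrdering (S : Setoid 0ℓ 0ℓ) : Set₁ where
  open Setoid S
  field
    _<_ : Carrier → Carrier → Set
    isStrictTotalOrder : IsStrictTotalOrder _≈_ _<_
    wellFounded : WellFounded _<_

-- The ambient ZFC axioms beyond Agda's constructive base:
-- excluded middle and the well-ordering theorem (equivalent to AC).
ZFC-Axioms : Set₁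
ZFC-Axioms = ExcludedMiddle 0ℓ × ((S : Setoid 0ℓ 0ℓ) → WellOrdering S)

GoodInjection : (InfSubset → InfSubset) → Set
GoodInjection f =
  (∀ x y → x ≐ᵢ y → f x ≐ᵢ f y) ×
  (∀ x y → f x ≐ᵢ f y → x ≐ᵢ y) ×
  (∀ x → proj₁ (f x) ⊊ proj₁ x)

module Submission where

-- Call x, y almost equal (x ≈* y) when they agree from some
-- point on.  Using a well-ordering of [ω]^ω, pick in every ≈*-class its least
-- element rep x; by excluded middle such least elements exist, and by
-- trichotomy they depend only on the class.  An anchor of x is a point m with
-- m ∈ rep x such that x and rep x agree from m on; let c x be the least anchor
-- and f x = x ∖ {c x}.  Then f x ⊊ x, since c x ∈ x.  For injectivity: f x is
-- almost equal to x, so f x ≐ f y forces x ≈* y and hence rep x ≐ rep y; but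
-- c x is the last point where f x differs from rep x, so it is recovered from
-- f x, and x = f x ∪ {c x}.

open import Defs
open import Level using (0ℓ)
open import Data.Product using (Σ; ∃; _×_; _,_; proj₁; proj₂)
open import Data.Nat using (ℕ; suc; _≤_; _<_; _⊔_; _≟_)
open import Data.Nat.Properties
  using (<-cmp; ≤-trans; ≤-refl; m≤m⊔n; m≤n⊔m; n≤1+n; <⇒≢)
open import Data.Nat.Induction using (<-wellFounded)
open import Data.Bool using (true; false)
open import Data.Empty using (⊥-elim)
open import Relation.Nullary using (¬_; yes; no)
open import Relation.Binary.PropositionalEquality
  using (_≡_; _≢_; refl; sym; trans; module ≡-Reasoning)
open import Relation.Binary.Bundles using (Setoid)
open import Relation.Binary.Structures using (IsStrictTotalOrder)
open import Relation.Binary.Definitions using (Trichotomous; tri<; tri≈; tri>)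
open import Induction.WellFounded using (WellFounded; Acc; acc)
open import Axiom.ExcludedMiddle using (ExcludedMiddle)

IsLeast : {A : Set} → (A → A → Set) → (A → Set) → A → Set
IsLeast _<_ P b = P b × (∀ c → P c → ¬ (c < b))

-- Under excluded middle, every inhabited predicate on a well-founded relation
-- has a least element: descend while a smaller witness exists.
least : ExcludedMiddle 0ℓ → {A : Set} (_<_ : A → A → Set) → WellFounded _<_ →
        (P : A → Set) → (a : A) → P a → Σ A (IsLeast _<_ P)
least lem {A} _<_ wf P a pa = descend a (wf a) pa
  where
  descend : (a : A) → Acc _<_ a → P a → Σ A (IsLeast _<_ P)
  descend a (acc smaller) pa with lem {Σ A λ b → b < a × P b}
  ... | yes (b , b<a , pb) = descend b (smaller b<a) pb
  ... | no none = a , pa , λ c pc c<a → none (c , c<a , pc)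

least-unique : {A : Set} {_≈_ _<_ : A → A → Set} → Trichotomous _≈_ _<_ →
               {P Q : A → Set} {b b' : A} →
               IsLeast _<_ P b → IsLeast _<_ Q b' → Q b → P b' → b ≈ b'
least-unique compare {b = b} {b'} (_ , minP) (_ , minQ) qb pb' with compare b b'
... | tri< b<b' _ _ = ⊥-elim (minQ b qb b<b')
... | tri≈ _ b≈b' _ = b≈b'
... | tri> _ _ b'<b = ⊥-elim (minP b' pb' b'<b)

_≈*_ : Subset → Subset → Set
x ≈* y = ∃ λ N → ∀ n → N ≤ n → x n ≡ y n

≐⇒≈* : ∀ {x y} → x ≐ y → x ≈* y
≐⇒≈* x≐y = 0 , λ n _ → x≐y n

≈*-sym : ∀ {x y} → x ≈* y → y ≈* x
≈*-sym (N , agree) = N , λ n N≤n → sym (agree n N≤n)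

≈*-trans : ∀ {x y z} → x ≈* y → y ≈* z → x ≈* z
≈*-trans (N , agree) (M , agree') = N ⊔ M , λ n le →
  trans (agree n (≤-trans (m≤m⊔n N M) le)) (agree' n (≤-trans (m≤n⊔m N M) le))

delete : ℕ → Subset → Subset
delete k s n with n ≟ k
... | yes _ = false
... | no _ = s n

delete-here : ∀ k s → delete k s k ≡ false
delete-here k s with k ≟ k
... | yes _ = refl
... | no k≢k = ⊥-elim (k≢k refl)

delete-elsewhere : ∀ k s n → n ≢ k → delete k s n ≡ s n
delete-elsewhere k s n n≢k with n ≟ k
... | yes n≡k = ⊥-elim (n≢k n≡k)
... | no _ = refl

delete-above : ∀ k s n → k < n → delete k s n ≡ s n
delete-above k s n k<n = delete-elsewhere k s n (λ n≡k → <⇒≢ k<n (sym n≡k))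

delete-⊆ : ∀ k s n → delete k s n ≡ true → s n ≡ true
delete-⊆ k s n h with n ≟ k
delete-⊆ k s n () | yes _
... | no _ = h

delete-⊊ : ∀ k s → s k ≡ true → delete k s ⊊ s
delete-⊊ k s k∈s = delete-⊆ k s , k , k∈s , delete-here k s

delete-≈* : ∀ k s → delete k s ≈* s
delete-≈* k s = suc k , delete-above k s

delete-infinite : ∀ k s → Infinite s → Infinite (delete k s)
delete-infinite k s inf n with inf (n ⊔ suc k)
... | m , le , m∈s = m , ≤-trans (m≤m⊔n n (suc k)) le ,
  trans (delete-above k s m (≤-trans (m≤n⊔m n (suc k)) le)) m∈s

Anchor : Subset → Subset → ℕ → Set
Anchor r s m = r m ≡ true × (∀ n → m ≤ n → s n ≡ r n)

anchor-exists : ∀ r s → Infinite r → s ≈* r → ∃ (Anchor r s)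
anchor-exists r s inf (N , agree) with inf N
... | m , N≤m , m∈r = m , m∈r , λ n m≤n → agree n (≤-trans N≤m m≤n)

anchor-resp : ∀ {r r' s s' m} → r ≐ r' → s ≐ s' → Anchor r s m → Anchor r' s' m
anchor-resp r≐r' s≐s' (m∈r , agree) =
  trans (sym (r≐r' _)) m∈r , λ n le → trans (sym (s≐s' n)) (trans (agree n le) (r≐r' n))

anchor-member : ∀ {r s m} → Anchor r s m → s m ≡ true
anchor-member (m∈r , agree) = trans (agree _ ≤-refl) m∈r

LastDifference : Subset → Subset → ℕ → Set
LastDifference s r m = s m ≢ r m × (∀ n → m < n → s n ≡ r n)

last-difference-unique : ∀ {s r m m'} →
  LastDifference s r m → LastDifference s r m' → m ≡ m'
last-difference-unique {m = m} {m'} (differ , agree) (differ' , agree') with <-cmp m m'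
... | tri< m<m' _ _ = ⊥-elim (differ' (agree m' m<m'))
... | tri≈ _ m≡m' _ = m≡m'
... | tri> _ _ m'<m = ⊥-elim (differ (agree' m m'<m))

last-difference-resp : ∀ {s s' r r' m} → s ≐ s' → r ≐ r' →
  LastDifference s r m → LastDifference s' r' m
last-difference-resp s≐s' r≐r' (differ , agree) =
  (λ eq → differ (trans (s≐s' _) (trans eq (sym (r≐r' _))))) ,
  λ n lt → trans (sym (s≐s' n)) (trans (agree n lt) (r≐r' n))

delete-anchor : ∀ {r s m} → Anchor r s m → LastDifference (delete m s) r m
delete-anchor {r} {s} {m} (m∈r , agree) =
  (λ eq → false≢true (trans (sym (delete-here m s)) (trans eq m∈r))) ,
  λ n m<n → trans (delete-above m s n m<n) (agree n (≤-trans (n≤1+n m) m<n))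
  where
  false≢true : false ≢ true
  false≢true ()

InfSubsetSetoid : Setoid 0ℓ 0ℓ
InfSubsetSetoid = record
  { Carrier = InfSubset
  ; _≈_ = _≐ᵢ_
  ; isEquivalence = record
    { refl = λ n → refl
    ; sym = λ e n → sym (e n)
    ; trans = λ e e' n → trans (e n) (e' n)
    }
  }

module Construction (lem : ExcludedMiddle 0ℓ) (wo : WellOrdering InfSubsetSetoid) where
  open WellOrdering wo renaming (_<_ to _≺_)
  open IsStrictTotalOrder isStrictTotalOrder using (compare)

  Class : InfSubset → InfSubset → Set
  Class x z = proj₁ z ≈* proj₁ x

  representative : (x : InfSubset) → Σ InfSubset (IsLeast _≺_ (Class x))
  representative x = least lem _≺_ wellFounded (Class x) x (≐⇒≈* (λ n → refl))

  rep : InfSubset → InfSubset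
  rep x = proj₁ (representative x)

  x≈*rep : ∀ x → proj₁ x ≈* proj₁ (rep x)
  x≈*rep x = ≈*-sym (proj₁ (proj₂ (representative x)))

  rep-resp : ∀ x y → proj₁ x ≈* proj₁ y → rep x ≐ᵢ rep y
  rep-resp x y x≈*y = least-unique compare
    (proj₂ (representative x)) (proj₂ (representative y))
    (≈*-trans (proj₁ (proj₂ (representative x))) x≈*y)
    (≈*-trans (proj₁ (proj₂ (representative y))) (≈*-sym x≈*y))

  AnchorOf : InfSubset → ℕ → Set
  AnchorOf x = Anchor (proj₁ (rep x)) (proj₁ x)

  leastAnchor : (x : InfSubset) → Σ ℕ (IsLeast _<_ (AnchorOf x))
  leastAnchor x with anchor-exists _ _ (proj₂ (rep x)) (x≈*rep x)
  ... | m , anchor = least lem _<_ <-wellFounded (AnchorOf x) m anchor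

  c : InfSubset → ℕ
  c x = proj₁ (leastAnchor x)

  c-anchor : ∀ x → AnchorOf x (c x)
  c-anchor x = proj₁ (proj₂ (leastAnchor x))

  f : InfSubset → InfSubset
  f x = delete (c x) (proj₁ x) , delete-infinite (c x) (proj₁ x) (proj₂ x)

  c-resp : ∀ x y → x ≐ᵢ y → c x ≡ c y
  c-resp x y x≐y = least-unique <-cmp (proj₂ (leastAnchor x)) (proj₂ (leastAnchor y))
    (anchor-resp rx≐ry x≐y (c-anchor x))
    (anchor-resp (λ n → sym (rx≐ry n)) (λ n → sym (x≐y n)) (c-anchor y))
    where
    rx≐ry : rep x ≐ᵢ rep y
    rx≐ry = rep-resp x y (≐⇒≈* x≐y)

  f-resp : ∀ x y → x ≐ᵢ y → f x ≐ᵢ f y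
  f-resp x y x≐y n with c x | c-resp x y x≐y
  ... | _ | refl = delete-resp n
    where
    delete-resp : ∀ n → delete (c y) (proj₁ x) n ≡ delete (c y) (proj₁ y) n
    delete-resp n with n ≟ c y
    ... | yes _ = refl
    ... | no _ = x≐y n

  f-proper : ∀ x → proj₁ (f x) ⊊ proj₁ x
  f-proper x = delete-⊊ (c x) (proj₁ x) (anchor-member (c-anchor x))

  -- f x is almost equal to x, so f x ≐ f y forces rep x ≐ rep y; then c x
  -- and c y are both the last difference of f x from rep x.
  f-determines-c : ∀ x y → f x ≐ᵢ f y → c x ≡ c y
  f-determines-c x y fx≐fy = last-difference-unique
    (delete-anchor (c-anchor x))
    (last-difference-resp (λ n → sym (fx≐fy n)) (λ n → sym (rx≐ry n))
      (delete-anchor (c-anchor y)))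
    where
    x≈*y : proj₁ x ≈* proj₁ y
    x≈*y = ≈*-trans (≈*-sym (delete-≈* (c x) (proj₁ x)))
             (≈*-trans (≐⇒≈* fx≐fy) (delete-≈* (c y) (proj₁ y)))
    rx≐ry : rep x ≐ᵢ rep y
    rx≐ry = rep-resp x y x≈*y

  -- x = f x ∪ {c x}, and c x is determined by f x.
  f-injective : ∀ x y → f x ≐ᵢ f y → x ≐ᵢ y
  f-injective x y fx≐fy n with n ≟ c x
  ... | yes refl = trans (anchor-member (c-anchor x)) (sym y∋cx)
    where
    y∋cx : proj₁ y (c x) ≡ true
    y∋cx rewrite f-determines-c x y fx≐fy = anchor-member (c-anchor y)
  ... | no n≢cx = begin
      proj₁ x n              ≡⟨ sym (delete-elsewhere (c x) (proj₁ x) n n≢cx) ⟩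
      proj₁ (f x) n          ≡⟨ fx≐fy n ⟩
      proj₁ (f y) n          ≡⟨ delete-elsewhere (c y) (proj₁ y) n n≢cy ⟩
      proj₁ y n              ∎
    where
    open ≡-Reasoning
    n≢cy : n ≢ c y
    n≢cy n≡cy = n≢cx (trans n≡cy (sym (f-determines-c x y fx≐fy)))

mainTheorem5 : ZFC-Axioms → Σ (InfSubset → InfSubset) GoodInjection
mainTheorem5 (lem , wellOrder) = f , f-resp , f-injective , f-proper
  where open Construction lem (wellOrder InfSubsetSetoid)
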